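{- Let $H$ be a Heyting algebra and $a\in H$. For every $\delta\in\mathcal D_a(H[\iota])$ (where $a$ denotes the constant map with value $a$), one has $\delta(1)\le\delta(\delta(1))$.
   Context: $\mathcal D_a(A)=\{d\in A: a\le d\text{ and }(d\to a)=a\}$ for $a$ in a Heyting algebra $A$. $H^{\mathcal D_a(H)}$ is the Heyting algebra of all maps $\mathcal D_a(H)\to H$ with pointwise operations; $H$ is identified with the subalgebra of constant maps. $\iota:\mathcal D_a(H)\to H$ is the inclusion map, and $H[\iota]\subseteq H^{\mathcal D_a(H)}$ is the subalgebra generated by the constant maps together with $\iota$. (Elements of $\mathcal D_a(H[\iota])$ are exactly the maps in $H[\iota]$ with values in $\mathcal D_a(H)$, so $\delta(1)\in\mathcal D_a(H)$ and $\delta(\delta(1))$ is defined.) -}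

module Defs where

open import Level using (_⊔_)
open import Data.Product using (Σ; _×_; _,_; proj₁; ∃)
open import Relation.Binary.Lattice.Bundles using (HeytingAlgebra)
import Relation.Binary.Lattice.Properties.HeytingAlgebra as HAProps

module _ {c ℓ₁ ℓ₂} (H : HeytingAlgebra c ℓ₁ ℓ₂) where
  open HeytingAlgebra H

  IsDₐ : Carrier → Carrier → Set (ℓ₁ ⊔ ℓ₂)
  IsDₐ a d = (a ≤ d) × ((d ⇨ a) ≈ a)

  Dₐ : Carrier → Set (c ⊔ ℓ₁ ⊔ ℓ₂)
  Dₐ a = Σ Carrier (IsDₐ a)

  -- Terms of the Heyting-algebra language over constants from H and one
  -- variable ι; they describe exactly the elements of H[ι].
  data Term : Set c where
    const : Carrier → Term
    ι     : Term
    top   : Term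
    bot   : Term
    _∧ₜ_  : Term → Term → Term
    _∨ₜ_  : Term → Term → Term
    _⇨ₜ_  : Term → Term → Term

  ⟦_⟧ : ∀ {a} → Term → Dₐ a → Carrier
  ⟦ const x ⟧ d = x
  ⟦ ι ⟧ d = proj₁ d
  ⟦ top ⟧ d = ⊤
  ⟦ bot ⟧ d = ⊥
  ⟦ s ∧ₜ t ⟧ d = ⟦ s ⟧ d ∧ ⟦ t ⟧ d
  ⟦ s ∨ₜ t ⟧ d = ⟦ s ⟧ d ∨ ⟦ t ⟧ d
  ⟦ s ⇨ₜ t ⟧ d = ⟦ s ⟧ d ⇨ ⟦ t ⟧ d

  -- f ∈ H[ι] ⊆ H^{D_a(H)}: f agrees pointwise with some generated term
  InHι : ∀ {a} → (Dₐ a → Carrier) → Set (c ⊔ ℓ₁ ⊔ ℓ₂)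
  InHι {a} f = ∃ λ (t : Term) → ∀ (d : Dₐ a) → f d ≈ ⟦ t ⟧ d

  InDₐHι : (a : Carrier) → (Dₐ a → Carrier) → Set (c ⊔ ℓ₁ ⊔ ℓ₂)
  InDₐHι a δ = InHι δ × (∀ d → a ≤ δ d) × (∀ d → (δ d ⇨ a) ≈ a)

  ⊤-IsDₐ : ∀ a → IsDₐ a ⊤
  ⊤-IsDₐ a = maximum a , antisym le ge
    where
    open HAProps H
    le : (⊤ ⇨ a) ≤ a
    le = trans (∧-greatest refl (maximum _)) ⇨-eval
    ge : a ≤ (⊤ ⇨ a)
    ge = swap-transpose-⇨ (x∧y≤y ⊤ a)

  ⊤ᴰ : ∀ a → Dₐ a
  ⊤ᴰ a = ⊤ , ⊤-IsDₐ a

  δ⊤ᴰ : ∀ a (δ : Dₐ a → Carrier) → InDₐHι a δ → Dₐ a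
  δ⊤ᴰ a δ (_ , p , q) = δ (⊤ᴰ a) , p (⊤ᴰ a) , q (⊤ᴰ a)

-- Every principal filter ↑x of a Heyting algebra induces a congruence
-- u ≈[ x ] v  :⇔  x ∧ u ≤ v and x ∧ v ≤ u, so every polynomial p of H[ι] satisfies
-- x ∧ p(d) ≈ x ∧ p(d') whenever x ∧ d ≈ x ∧ d'.  Take x = e = δ(1): then
-- 1 ≈[ e ] e, hence e = e ∧ δ(1) ≤ δ(e).  Membership of δ in D_a(H[ι]) is only
-- needed to make δ(δ(1)) defined.
module Submission where

open import Defs
open import Relation.Binary.Lattice.Bundles using (HeytingAlgebra)
open import Data.Product using (_×_; _,_; proj₁)
import Relation.Binary.Lattice.Properties.HeytingAlgebra as HeytingProperties
import Relation.Binary.Lattice.Properties.JoinSemilattice as JoinProperties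
import Relation.Binary.Lattice.Properties.MeetSemilattice as MeetProperties
import Relation.Binary.Reasoning.PartialOrder as ≤-Reasoning

module RelativeOrder {c ℓ₁ ℓ₂} (H : HeytingAlgebra c ℓ₁ ℓ₂) where
  open HeytingAlgebra H
  open HeytingProperties H using (⇨-applyˡ; ∧-distribˡ-∨-≤)
  open JoinProperties joinSemilattice using (∨-monotonic)
  open MeetProperties meetSemilattice using (∧-monotonic)
  open ≤-Reasoning poset

  infix 4 _≤[_]_ _≈[_]_

  ⟦_⟧ᴴ : ∀ {a} → Term H → Dₐ H a → Carrier
  ⟦_⟧ᴴ = ⟦_⟧ H

  _≤[_]_ : Carrier → Carrier → Carrier → Set ℓ₂
  u ≤[ x ] v = x ∧ u ≤ v

  _≈[_]_ : Carrier → Carrier → Carrier → Set ℓ₂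
  u ≈[ x ] v = (u ≤[ x ] v) × (v ≤[ x ] u)

  ≈[]-refl : ∀ {x u} → u ≈[ x ] u
  ≈[]-refl = x∧y≤y _ _ , x∧y≤y _ _

  ∧-mono-≤[] : ∀ {x u u′ v v′} → u ≤[ x ] u′ → v ≤[ x ] v′ → u ∧ v ≤[ x ] u′ ∧ v′
  ∧-mono-≤[] {x} {u} {u′} {v} {v′} p q = begin
    x ∧ (u ∧ v)        ≤⟨ ∧-greatest (∧-monotonic refl (x∧y≤x u v))
                                     (∧-monotonic refl (x∧y≤y u v)) ⟩
    (x ∧ u) ∧ (x ∧ v)  ≤⟨ ∧-monotonic p q ⟩
    u′ ∧ v′            ∎

  ∨-mono-≤[] : ∀ {x u u′ v v′} → u ≤[ x ] u′ → v ≤[ x ] v′ → u ∨ v ≤[ x ] u′ ∨ v′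
  ∨-mono-≤[] {x} {u} {u′} {v} {v′} p q = begin
    x ∧ (u ∨ v)        ≤⟨ ∧-distribˡ-∨-≤ x u v ⟩
    (x ∧ u) ∨ (x ∧ v)  ≤⟨ ∨-monotonic p q ⟩
    u′ ∨ v′            ∎

  ⇨-relax-≤[] : ∀ {x u u′ v v′} → u′ ≤[ x ] u → v ≤[ x ] v′ → u ⇨ v ≤[ x ] u′ ⇨ v′
  ⇨-relax-≤[] {x} {u} {u′} {v} {v′} p q = transpose-⇨ (begin
    (x ∧ (u ⇨ v)) ∧ u′             ≤⟨ ∧-greatest (trans (x∧y≤x _ _) (x∧y≤x x (u ⇨ v)))
                                      (∧-greatest (trans (x∧y≤x _ _) (x∧y≤y x (u ⇨ v)))
                                                  (∧-monotonic (x∧y≤x x (u ⇨ v)) refl)) ⟩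
    x ∧ ((u ⇨ v) ∧ (x ∧ u′))       ≤⟨ ∧-monotonic refl (⇨-applyˡ p) ⟩
    x ∧ v                          ≤⟨ q ⟩
    v′                             ∎)

  ∧-cong-≈[] : ∀ {x u u′ v v′} → u ≈[ x ] u′ → v ≈[ x ] v′ → u ∧ v ≈[ x ] u′ ∧ v′
  ∧-cong-≈[] (p , p′) (q , q′) = ∧-mono-≤[] p q , ∧-mono-≤[] p′ q′

  ∨-cong-≈[] : ∀ {x u u′ v v′} → u ≈[ x ] u′ → v ≈[ x ] v′ → u ∨ v ≈[ x ] u′ ∨ v′
  ∨-cong-≈[] (p , p′) (q , q′) = ∨-mono-≤[] p q , ∨-mono-≤[] p′ q′

  ⇨-cong-≈[] : ∀ {x u u′ v v′} → u ≈[ x ] u′ → v ≈[ x ] v′ → u ⇨ v ≈[ x ] u′ ⇨ v′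
  ⇨-cong-≈[] (p , p′) (q , q′) = ⇨-relax-≤[] p′ q , ⇨-relax-≤[] p q′

  ⊤≈[]self : ∀ x → ⊤ ≈[ x ] x
  ⊤≈[]self x = x∧y≤x x ⊤ , trans (x∧y≤x x x) (maximum x)

  ⟦⟧-cong-≈[] : ∀ {a x} (t : Term H) {d d′ : Dₐ H a}
              → proj₁ d ≈[ x ] proj₁ d′ → ⟦ t ⟧ᴴ d ≈[ x ] ⟦ t ⟧ᴴ d′
  ⟦⟧-cong-≈[] (const _) _ = ≈[]-refl
  ⟦⟧-cong-≈[] ι         p = p
  ⟦⟧-cong-≈[] top       _ = ≈[]-refl
  ⟦⟧-cong-≈[] bot       _ = ≈[]-refl
  ⟦⟧-cong-≈[] (s ∧ₜ t)  p = ∧-cong-≈[] (⟦⟧-cong-≈[] s p) (⟦⟧-cong-≈[] t p)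
  ⟦⟧-cong-≈[] (s ∨ₜ t)  p = ∨-cong-≈[] (⟦⟧-cong-≈[] s p) (⟦⟧-cong-≈[] t p)
  ⟦⟧-cong-≈[] (s ⇨ₜ t)  p = ⇨-cong-≈[] (⟦⟧-cong-≈[] s p) (⟦⟧-cong-≈[] t p)

  ⟦⟧-⊤≤⟦⟧-at-⟦⟧-⊤ : ∀ {a} (t : Term H) (d : Dₐ H a)
                  → proj₁ d ≈ ⟦ t ⟧ᴴ (⊤ᴰ H a) → ⟦ t ⟧ᴴ (⊤ᴰ H a) ≤ ⟦ t ⟧ᴴ d
  ⟦⟧-⊤≤⟦⟧-at-⟦⟧-⊤ {a} t d d≈ = begin
    e            ≤⟨ ∧-greatest refl refl ⟩
    e ∧ e        ≤⟨ ∧-monotonic (reflexive (Eq.sym d≈)) refl ⟩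
    proj₁ d ∧ e  ≤⟨ proj₁ (⟦⟧-cong-≈[] t (⊤≈[]self (proj₁ d))) ⟩
    ⟦ t ⟧ᴴ d     ∎
    where
    e : Carrier
    e = ⟦ t ⟧ᴴ (⊤ᴰ H a)

corollary3p3 : ∀ {c ℓ₁ ℓ₂} (H : HeytingAlgebra c ℓ₁ ℓ₂)
    → let open HeytingAlgebra H in
    (a : Carrier) (δ : Dₐ H a → Carrier) (hδ : InDₐHι H a δ)
    → δ (⊤ᴰ H a) ≤ δ (δ⊤ᴰ H a δ hδ)
corollary3p3 H a δ hδ@((t , δ≈⟦t⟧) , _) = begin
  δ ⊤ᴰa        ≈⟨ δ≈⟦t⟧ ⊤ᴰa ⟩
  ⟦ t ⟧ᴴ ⊤ᴰa   ≤⟨ ⟦⟧-⊤≤⟦⟧-at-⟦⟧-⊤ t δ⊤ (δ≈⟦t⟧ ⊤ᴰa) ⟩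
  ⟦ t ⟧ᴴ δ⊤    ≈⟨ Eq.sym (δ≈⟦t⟧ δ⊤) ⟩
  δ δ⊤         ∎
  where
  open HeytingAlgebra H
  open RelativeOrder H
  open ≤-Reasoning poset
  ⊤ᴰa δ⊤ : Dₐ H a
  ⊤ᴰa = ⊤ᴰ H a
  δ⊤ = δ⊤ᴰ H a δ hδ
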